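{- Let $a \geq 2$ be an integer. Then $\textbf{w}_{\geq a} = \textbf{w}_a$.
   Context: A factor is a contiguous subword. For relatively prime positive integers $p,q$ and a nonempty word $v$ whose length is divisible by $q$, define $v^{p/q} = v^{\lfloor p/q \rfloor} v_0 v_1 \cdots v_{t-1}$, where $t = |v|\,(p/q - \lfloor p/q\rfloor)$; such a word is called a $\frac{p}{q}$-power (for an integer $a$, an $a$-power is $v^a$ with $v$ nonempty). A word avoids $\frac{p}{q}$-powers if none of its factors is a $\frac{p}{q}$-power. For $\frac{a}{b}>1$ with $a,b$ coprime, $\textbf{w}_{a/b}$ is the lexicographically least infinite word over $\mathbb{Z}_{\geq 0}$ avoiding $\frac{a}{b}$-powers, and $\textbf{w}_{\geq a/b}$ is the lexicographically least infinite word over $\mathbb{Z}_{\geq 0}$ avoiding $\frac{p}{q}$-powers for all rationals $\frac{p}{q} \geq \frac{a}{b}$ (written in lowest terms). For an integer $a$, $\textbf{w}_a = \textbf{w}_{a/1}$ and $\textbf{w}_{\geq a} = \textbf{w}_{\geq a/1}$. -}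

module Defs where

open import Data.Nat using (ℕ; zero; suc; _+_; _*_; _≤_; _<_; NonZero)
open import Data.Nat.DivMod using (_/_; _%_)
open import Data.Nat.Divisibility using (_∣_)
open import Data.Nat.Coprimality using (Coprime)
open import Data.List using (List; []; _++_; length; take; map; upTo)
open import Data.Product using (Σ; _×_)
open import Relation.Binary.PropositionalEquality using (_≡_)
open import Relation.Nullary using (¬_)

Word : Set
Word = ℕ → ℕ

rep : List ℕ → ℕ → List ℕ
rep v zero    = []
rep v (suc k) = v ++ rep v k

-- v^{p/q} = v^{⌊p/q⌋} v_0 ... v_{t-1},  t = |v| (p/q - ⌊p/q⌋) = (|v|/q) * (p mod q)
-- (the latter equality holds since q ∣ |v|, which is required below).
fracPow : (v : List ℕ) (p q : ℕ) .{{_ : NonZero q}} → List ℕ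
fracPow v p q = rep v (p / q) ++ take ((length v / q) * (p % q)) v

IsFracPower : (p q : ℕ) .{{_ : NonZero q}} → List ℕ → Set
IsFracPower p q x =
  Σ (List ℕ) λ v → (0 < length v) × (q ∣ length v) × (x ≡ fracPow v p q)

factor : Word → ℕ → ℕ → List ℕ
factor w i n = map (λ k → w (i + k)) (upTo n)

AvoidsFrac : (p q : ℕ) .{{_ : NonZero q}} → Word → Set
AvoidsFrac p q w = ∀ i n → ¬ IsFracPower p q (factor w i n)

AvoidsPow : ℕ → Word → Set
AvoidsPow a w = AvoidsFrac a 1 w

AvoidsGe : ℕ → Word → Set
AvoidsGe a w =
  ∀ p q .{{_ : NonZero q}} → Coprime p q → a * q ≤ p → AvoidsFrac p q w

-- Lexicographic order on infinite words: w ≤lex w'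
-- (at the first position where they differ, w is smaller).
LexLE : Word → Word → Set
LexLE w w' = ∀ i → (∀ j → j < i → w j ≡ w' j) → w i ≤ w' i

LexLeast : (Word → Set) → Word → Set
LexLeast P w = P w × (∀ w' → P w' → LexLE w w')

module Submission where

-- Both are the a-ruler word
--   w = ν(1) ν(2) ν(3) …,   ν(n) = exponent of the largest power of a dividing n.
--
-- Dually, a p/q-power factor has
--    period |v| on its first ⌊p/q⌋·|v| letters.
--  * The valuation ν, characterised by  a^d ∣ n ⇔ d ≤ ν n  (n > 0), and its
--    consequences: ν(n·a) = ν(n) + 1, exact valuations, and invariance of ν
--    under adding multiples of a^c away from multiples of a^(c+1).
--  * Aperiodicity: ν has no window of length a·L with period L.  Such an L is
--    a multiple of a, and dividing by a yields a window with period L/a, so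
--    the claim follows by strong induction on L.  Since a p/q-power with
--    p/q ≥ a has ⌊p/q⌋ ≥ a full periods, w avoids all these powers.
--  * Minimality: if u agrees with w before i and u(i) = c < ν(i+1), then
--    i + 1 = (M+1)·a^(c+1), and u contains the a-power of period a^c which
--    ends at position i.  Hence w is ≤lex every word avoiding a-powers.
-- The theorem then follows because avoiding all ≥a-powers implies avoiding
-- a-powers, so least-ness for the larger class restricts to the smaller one.

open import Defs
open import Data.Nat
open import Data.Nat.Properties
open import Data.Nat.Divisibility
open import Data.Nat.DivMod
  using (_/_; _%_; m≡m%n+[m/n]*n; m%n<n; [m+n]%n≡m%n; m<n⇒m%n≡m; n/1≡n; n%1≡0; m*n/n≡m; /-monoˡ-≤)
open import Data.Nat.Coprimality using (1-coprimeTo) renaming (sym to coprime-sym)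
open import Data.Nat.Induction using (<-rec)
open import Data.List using (List; []; _∷_; _++_; length; take; map; upTo; applyUpTo)
open import Data.List.Properties using (length-map; length-applyUpTo; length-++; length-++-≤ˡ; ++-identityʳ)
open import Data.Product using (Σ; _×_; _,_; proj₁; proj₂)
open import Data.Empty using (⊥-elim)
open import Function using (id; _∘_)
open import Relation.Nullary using (¬_; yes; no)
open import Relation.Binary.PropositionalEquality
open import Data.Nat.Solver using (module +-*-Solver)
open +-*-Solver using (solve; _:=_; _:+_; _:*_; con)
open ≡-Reasoning

-- Indexing into a list (with a dummy value outside its range).
nth : List ℕ → ℕ → ℕ
nth []       _       = 0
nth (x ∷ xs) zero    = x
nth (x ∷ xs) (suc k) = nth xs k

nth-map-applyUpTo : ∀ (f g : ℕ → ℕ) n k → k < n → nth (map f (applyUpTo g n)) k ≡ f (g k)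
nth-map-applyUpTo f g (suc n) zero    _         = refl
nth-map-applyUpTo f g (suc n) (suc k) (s≤s k<n) = nth-map-applyUpTo f (g ∘ suc) n k k<n

nth-factor : ∀ (u : Word) i n k → k < n → nth (factor u i n) k ≡ u (i + k)
nth-factor u i n = nth-map-applyUpTo (λ k → u (i + k)) id n

length-factor : ∀ (u : Word) i n → length (factor u i n) ≡ n
length-factor u i n = trans (length-map _ (upTo n)) (length-applyUpTo id n)

nth-++ˡ : ∀ xs ys k → k < length xs → nth (xs ++ ys) k ≡ nth xs k
nth-++ˡ (x ∷ xs) ys zero    _         = refl
nth-++ˡ (x ∷ xs) ys (suc k) (s≤s k<n) = nth-++ˡ xs ys k k<n

nth-++ʳ : ∀ xs ys k → nth (xs ++ ys) (length xs + k) ≡ nth ys k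
nth-++ʳ []       ys k = refl
nth-++ʳ (x ∷ xs) ys k = nth-++ʳ xs ys k

length-rep : ∀ v b → length (rep v b) ≡ b * length v
length-rep v zero    = refl
length-rep v (suc b) = trans (length-++ v) (cong (length v +_) (length-rep v b))

nth-rep : ∀ v b k {L} .{{_ : NonZero L}} → length v ≡ L → k < b * L →
          nth (rep v b) k ≡ nth v (k % L)
nth-rep v (suc b) k refl k<bL with k <? length v
... | yes k<L = trans (nth-++ˡ v (rep v b) k k<L) (cong (nth v) (sym (m<n⇒m%n≡m k<L)))
... | no  k≮L = begin
  nth (v ++ rep v b) k        ≡⟨ cong (nth (v ++ rep v b)) (sym L+k′≡k) ⟩
  nth (v ++ rep v b) (L + k′) ≡⟨ nth-++ʳ v (rep v b) k′ ⟩
  nth (rep v b) k′            ≡⟨ nth-rep v b k′ refl k′<bL ⟩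
  nth v (k′ % L)              ≡⟨ cong (nth v) (sym ([m+n]%n≡m%n k′ L)) ⟩
  nth v ((k′ + L) % L)        ≡⟨ cong (λ x → nth v (x % L)) (trans (+-comm k′ L) L+k′≡k) ⟩
  nth v (k % L)               ∎
  where
  L k′ : ℕ
  L  = length v
  k′ = k ∸ L
  L+k′≡k : L + k′ ≡ k
  L+k′≡k = m+[n∸m]≡n (≮⇒≥ k≮L)
  k′<bL : k′ < b * L
  k′<bL = +-cancelˡ-< L k′ (b * L) (subst (_< L + b * L) (sym L+k′≡k) k<bL)

list-ext : ∀ xs ys → length xs ≡ length ys → (∀ k → k < length xs → nth xs k ≡ nth ys k) → xs ≡ ys
list-ext []       []       _  _    = refl
list-ext (x ∷ xs) (y ∷ ys) eq same =
  cong₂ _∷_ (same 0 z<s) (list-ext xs ys (suc-injective eq) (λ k k<n → same (suc k) (s<s k<n)))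

factor-rep : ∀ (u : Word) s b L .{{_ : NonZero L}} →
             (∀ k → k < b * L → u (s + k) ≡ u (s + k % L)) →
             factor u s (b * L) ≡ rep (factor u s L) b
factor-rep u s b L periodic = list-ext _ _ same-length same-letters
  where
  v : List ℕ
  v = factor u s L
  same-length : length (factor u s (b * L)) ≡ length (rep v b)
  same-length = trans (length-factor u s (b * L))
                      (sym (trans (length-rep v b) (cong (b *_) (length-factor u s L))))
  same-letters : ∀ k → k < length (factor u s (b * L)) → nth (factor u s (b * L)) k ≡ nth (rep v b) k
  same-letters k k<n = begin
    nth (factor u s (b * L)) k ≡⟨ nth-factor u s (b * L) k k<bL ⟩
    u (s + k)                  ≡⟨ periodic k k<bL ⟩
    u (s + k % L)              ≡⟨ sym (nth-factor u s L (k % L) (m%n<n k L)) ⟩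
    nth v (k % L)              ≡⟨ sym (nth-rep v b k (length-factor u s L) k<bL) ⟩
    nth (rep v b) k            ∎
    where
    k<bL : k < b * L
    k<bL = subst (k <_) (length-factor u s (b * L)) k<n

fracPow-integer : ∀ v b → fracPow v b 1 ≡ rep v b
fracPow-integer v b = begin
  rep v (b / 1) ++ take (length v / 1 * (b % 1)) v ≡⟨ cong₂ (λ e t → rep v e ++ take t v) (n/1≡n b) no-tail ⟩
  rep v b ++ []                                     ≡⟨ ++-identityʳ (rep v b) ⟩
  rep v b                                           ∎
  where
  no-tail : length v / 1 * (b % 1) ≡ 0
  no-tail = trans (cong (length v / 1 *_) (n%1≡0 b)) (*-zeroʳ (length v / 1))

HasPeriod : Word → (i n L : ℕ) → Set
HasPeriod u i n L = ∀ k → k + L < n → u (i + k) ≡ u (i + k + L)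

fracPow-period : ∀ (u : Word) i n v p q .{{_ : NonZero q}} .{{_ : NonZero (length v)}} →
                 factor u i n ≡ fracPow v p q → HasPeriod u i ((p / q) * length v) (length v)
fracPow-period u i n v p q eq k k+L<bL = begin
  u (i + k)           ≡⟨ letter k (≤-<-trans (m≤m+n k L) k+L<bL) ⟩
  nth v (k % L)       ≡⟨ cong (nth v) (sym ([m+n]%n≡m%n k L)) ⟩
  nth v ((k + L) % L) ≡⟨ sym (letter (k + L) k+L<bL) ⟩
  u (i + (k + L))     ≡⟨ cong u (sym (+-assoc i k L)) ⟩
  u (i + k + L)       ∎
  where
  L b : ℕ
  L = length v
  b = p / q
  bL≤n : b * L ≤ n
  bL≤n = ≤-trans (≤-reflexive (sym (length-rep v b)))
           (≤-trans (length-++-≤ˡ (rep v b))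
             (≤-reflexive (trans (cong length (sym eq)) (length-factor u i n))))
  letter : ∀ k → k < b * L → u (i + k) ≡ nth v (k % L)
  letter k k<bL = begin
    u (i + k)                   ≡⟨ nth-factor u i n k (<-≤-trans k<bL bL≤n) ⟨
    nth (factor u i n) k        ≡⟨ cong (λ x → nth x k) eq ⟩
    nth (rep v b ++ _) k        ≡⟨ nth-++ˡ (rep v b) _ k (subst (k <_) (sym (length-rep v b)) k<bL) ⟩
    nth (rep v b) k             ≡⟨ nth-rep v b k refl k<bL ⟩
    nth v (k % L)               ∎

∣m+n∣n⇒∣m : ∀ {d m n} → d ∣ m + n → d ∣ n → d ∣ m
∣m+n∣n⇒∣m {d} {m} {n} d∣m+n = ∣m+n∣m⇒∣n (subst (d ∣_) (+-comm m n) d∣m+n)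

∤⇒pos : ∀ {d x} → ¬ (d ∣ x) → 0 < x
∤⇒pos {d} {zero}  d∤0 = ⊥-elim (d∤0 (d ∣0))
∤⇒pos {d} {suc x} _   = z<s

module Ruler (a′ : ℕ) where

  a : ℕ
  a = suc (suc a′)

  ^-∣-mono : ∀ {d c} → d ≤ c → a ^ d ∣ a ^ c
  ^-∣-mono {d} {c} d≤c = divides (a ^ (c ∸ d)) (begin
    a ^ c                 ≡⟨ cong (a ^_) (m+[n∸m]≡n d≤c) ⟨
    a ^ (d + (c ∸ d))     ≡⟨ ^-distribˡ-+-* a d (c ∸ d) ⟩
    a ^ d * a ^ (c ∸ d)   ≡⟨ *-comm (a ^ d) (a ^ (c ∸ d)) ⟩
    a ^ (c ∸ d) * a ^ d   ∎)

  valuationWithin : ℕ → ℕ → ℕ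
  valuationWithin zero    n = 0
  valuationWithin (suc f) n with a ∣? n
  ... | yes (divides q _) = suc (valuationWithin f q)
  ... | no  _             = 0

  valuationWithin-spec : ∀ f n → 0 < n → n ≤ f → ∀ d →
                         (d ≤ valuationWithin f n → a ^ d ∣ n) × (a ^ d ∣ n → d ≤ valuationWithin f n)
  valuationWithin-spec zero    (suc n) _ () d
  valuationWithin-spec (suc f) n 0<n n≤f d with a ∣? n
  valuationWithin-spec (suc f) n 0<n n≤f zero    | yes _ = (λ _ → 1∣ n) , (λ _ → z≤n)
  valuationWithin-spec (suc f) n 0<n n≤f (suc d) | yes (divides zero n≡0) = ⊥-elim (<⇒≢ 0<n (sym n≡0))
  valuationWithin-spec (suc f) n 0<n n≤f (suc d) | yes (divides q@(suc _) n≡qa) =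
      (λ { (s≤s d≤ν) → subst (a ^ suc d ∣_) (sym n≡aq) (*-monoʳ-∣ a (proj₁ IH d≤ν)) })
    , (λ a^d+1∣n → s≤s (proj₂ IH (*-cancelˡ-∣ a (subst (a ^ suc d ∣_) n≡aq a^d+1∣n))))
    where
    n≡aq : n ≡ a * q
    n≡aq = trans n≡qa (*-comm q a)
    q<n : q < n
    q<n = subst (q <_) (sym n≡qa) (m<m*n q a (s≤s (s≤s z≤n)))
    IH : (d ≤ valuationWithin f q → a ^ d ∣ q) × (a ^ d ∣ q → d ≤ valuationWithin f q)
    IH = valuationWithin-spec f q z<s (≤-pred (≤-trans q<n n≤f)) d
  valuationWithin-spec (suc f) n 0<n n≤f zero    | no _   = (λ _ → 1∣ n) , (λ _ → z≤n)
  valuationWithin-spec (suc f) n 0<n n≤f (suc d) | no a∤n =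
    (λ ()) , (λ a^d+1∣n → ⊥-elim (a∤n (∣-trans (m∣m*n (a ^ d)) a^d+1∣n)))

  -- The a-adic valuation (n itself is enough fuel, as each division shrinks n).
  ν : ℕ → ℕ
  ν n = valuationWithin n n

  ν-sound : ∀ {n} d → 0 < n → d ≤ ν n → a ^ d ∣ n
  ν-sound {n} d 0<n = proj₁ (valuationWithin-spec n n 0<n ≤-refl d)

  ν-maximal : ∀ {n} d → 0 < n → a ^ d ∣ n → d ≤ ν n
  ν-maximal {n} d 0<n = proj₂ (valuationWithin-spec n n 0<n ≤-refl d)

  ν-exact : ∀ {x} c → a ^ c ∣ x → ¬ (a ^ suc c ∣ x) → ν x ≡ c
  ν-exact {x} c a^c∣x a^c+1∤x with ν x ≤? c
  ... | yes ν≤c = ≤-antisym ν≤c (ν-maximal c (∤⇒pos a^c+1∤x) a^c∣x)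
  ... | no  ν≰c = ⊥-elim (a^c+1∤x (ν-sound (suc c) (∤⇒pos a^c+1∤x) (≰⇒> ν≰c)))

  ν-unique : ∀ {x y} → 0 < x → 0 < y →
             (∀ d → a ^ d ∣ x → a ^ d ∣ y) → (∀ d → a ^ d ∣ y → a ^ d ∣ x) → ν x ≡ ν y
  ν-unique {x} {y} 0<x 0<y x⇒y y⇒x = ≤-antisym
    (ν-maximal (ν x) 0<y (x⇒y (ν x) (ν-sound (ν x) 0<x ≤-refl)))
    (ν-maximal (ν y) 0<x (y⇒x (ν y) (ν-sound (ν y) 0<y ≤-refl)))

  ν-*a : ∀ {n} → 0 < n → ν (n * a) ≡ suc (ν n)
  ν-*a {n} 0<n = ν-exact (suc (ν n)) divides-next not-divides
    where
    a∣-comm : ∀ {m} → a * m ∣ n * a → m ∣ n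
    a∣-comm {m} = *-cancelˡ-∣ a ∘ subst (a * m ∣_) (*-comm n a)
    divides-next : a ^ suc (ν n) ∣ n * a
    divides-next = subst (a ^ suc (ν n) ∣_) (*-comm a n) (*-monoʳ-∣ a (ν-sound (ν n) 0<n ≤-refl))
    not-divides : ¬ (a ^ suc (suc (ν n)) ∣ n * a)
    not-divides a^ν+2∣na = <-irrefl refl (ν-maximal (suc (ν n)) 0<n (a∣-comm a^ν+2∣na))

  ν-transfer-∣ : ∀ {x y} → 0 < x → 0 < y → ν x ≡ ν y → a ∣ x → a ∣ y
  ν-transfer-∣ {x} {y} 0<x 0<y νx≡νy a∣x = subst (_∣ y) (*-identityʳ a)
    (ν-sound 1 0<y (subst (1 ≤_) νx≡νy (ν-maximal 1 0<x (subst (_∣ x) (sym (*-identityʳ a)) a∣x))))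

  -- Adding a multiple of a^c does not change ν, as long as neither number
  -- is divisible by a^(c+1): both then have valuation at most c.
  ν-shift : ∀ c x t → ¬ (a ^ suc c ∣ x) → ¬ (a ^ suc c ∣ x + t * a ^ c) → ν x ≡ ν (x + t * a ^ c)
  ν-shift c x t x∤ y∤ = ν-unique (∤⇒pos x∤) (∤⇒pos y∤) up down
    where
    small : ∀ {d z} → ¬ (a ^ suc c ∣ z) → a ^ d ∣ z → a ^ d ∣ t * a ^ c
    small {d} z∤ a^d∣z with d ≤? c
    ... | yes d≤c = ∣-trans (^-∣-mono d≤c) (n∣m*n t)
    ... | no  d≰c = ⊥-elim (z∤ (∣-trans (^-∣-mono (≰⇒> d≰c)) a^d∣z))
    up : ∀ d → a ^ d ∣ x → a ^ d ∣ x + t * a ^ c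
    up d a^d∣x = ∣m∣n⇒∣m+n a^d∣x (small {d} x∤ a^d∣x)
    down : ∀ d → a ^ d ∣ x + t * a ^ c → a ^ d ∣ x
    down d a^d∣y = ∣m+n∣n⇒∣m a^d∣y (small {d} y∤ a^d∣y)

  next-multiple : ∀ m → Σ ℕ λ k → k < a × a ∣ m + k
  next-multiple zero = 0 , z<s , divides 0 refl
  next-multiple (suc m) with next-multiple m
  ... | suc k , k<a , a∣m+k = k , <⇒≤ k<a , subst (a ∣_) (+-suc m k) a∣m+k
  ... | zero  , _   , a∣m+0 = suc a′ , ≤-refl ,
        subst (a ∣_) (cong suc (+-comm (suc a′) m))
          (∣m∣n⇒∣m+n (∣-refl {a}) (subst (a ∣_) (+-identityʳ m) a∣m+0))

  pos+ : ∀ {m} k → 0 < m → 0 < m + k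
  pos+ {m} k 0<m = <-≤-trans 0<m (m≤m+n m k)

  -- A period of ν on a window of length a·L is a multiple of a: compare the
  -- multiple of a among the first a positions with its neighbour at distance L.
  period-divisible : ∀ {L m} → 0 < L → 0 < m → HasPeriod ν m (a * L) L → a ∣ L
  period-divisible {L} {m} 0<L 0<m per with next-multiple m
  ... | k , k<a , a∣m+k with k + L <? a * L
  ...   | yes inside = ∣m+n∣m⇒∣n (ν-transfer-∣ (pos+ k 0<m) (pos+ L (pos+ k 0<m)) (per k inside) a∣m+k) a∣m+k
  ...   | no  beyond = ∣m+n∣m⇒∣n (subst (a ∣_) (sym m+k′+L≡m+k) a∣m+k) a∣m+k′
    where
    L≤k : L ≤ k
    L≤k = ≤-trans (m≤m+n L (a′ * L)) (+-cancelˡ-≤ L _ k (subst (a * L ≤_) (+-comm k L) (≮⇒≥ beyond)))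
    k′ : ℕ
    k′ = k ∸ L
    k′+L≡k : k′ + L ≡ k
    k′+L≡k = m∸n+n≡m L≤k
    m+k′+L≡m+k : m + k′ + L ≡ m + k
    m+k′+L≡m+k = trans (+-assoc m k′ L) (cong (m +_) k′+L≡k)
    k′+L<aL : k′ + L < a * L
    k′+L<aL = subst (_< a * L) (sym k′+L≡k) (<-≤-trans k<a (m≤m*n a L {{>-nonZero 0<L}}))
    a∣m+k′ : a ∣ m + k′
    a∣m+k′ = ν-transfer-∣ (pos+ k 0<m) (pos+ k′ 0<m)
               (trans (cong ν (sym m+k′+L≡m+k)) (sym (per k′ k′+L<aL))) a∣m+k

  period-contract : ∀ {L′ m k t} → k < a → m + k ≡ t * a → 0 < t →
                    HasPeriod ν m (a * (L′ * a)) (L′ * a) → HasPeriod ν t (a * L′) L′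
  period-contract {L′} {m} {k} {t} k<a m+k≡ta 0<t per j j+L′<aL′ = suc-injective (begin
    suc (ν (t + j))                  ≡⟨ ν-*a (pos+ j 0<t) ⟨
    ν ((t + j) * a)                  ≡⟨ cong ν left ⟩
    ν (m + (k + a * j))              ≡⟨ per (k + a * j) bound ⟩
    ν (m + (k + a * j) + L′ * a)     ≡⟨ cong ν right ⟨
    ν ((t + j + L′) * a)             ≡⟨ ν-*a (pos+ L′ (pos+ j 0<t)) ⟩
    suc (ν (t + j + L′))             ∎)
    where
    left : (t + j) * a ≡ m + (k + a * j)
    left = begin
      (t + j) * a         ≡⟨ *-distribʳ-+ a t j ⟩
      t * a + j * a       ≡⟨ cong₂ _+_ (sym m+k≡ta) (*-comm j a) ⟩
      m + k + a * j       ≡⟨ +-assoc m k (a * j) ⟩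
      m + (k + a * j)     ∎
    right : (t + j + L′) * a ≡ m + (k + a * j) + L′ * a
    right = trans (*-distribʳ-+ a (t + j) L′) (cong (_+ L′ * a) left)
    bound : k + a * j + L′ * a < a * (L′ * a)
    bound = <-≤-trans (subst (k + a * j + L′ * a <_) regroup (+-monoˡ-< (L′ * a) (+-monoˡ-< (a * j) k<a)))
                      (subst (a * suc (j + L′) ≤_) (cong (a *_) (*-comm a L′)) (*-monoʳ-≤ a j+L′<aL′))
      where
      regroup : a + a * j + L′ * a ≡ a * suc (j + L′)
      regroup = solve 3 (λ a j l → a :+ a :* j :+ l :* a := a :* (con 1 :+ j :+ l)) refl a j L′

  ruler-aperiodic : ∀ L m → 0 < L → 0 < m → ¬ HasPeriod ν m (a * L) L
  ruler-aperiodic = <-rec Aperiodic step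
    where
    Aperiodic : ℕ → Set
    Aperiodic L = ∀ m → 0 < L → 0 < m → ¬ HasPeriod ν m (a * L) L
    step : ∀ L → (∀ {L′} → L′ < L → Aperiodic L′) → Aperiodic L
    step L smaller m 0<L 0<m per with period-divisible 0<L 0<m per | next-multiple m
    ... | divides zero     L≡0   | _ = <⇒≢ 0<L (sym L≡0)
    ... | divides (suc _)  _     | _ , _ , divides zero m+k≡0 = <⇒≢ (pos+ _ 0<m) (sym m+k≡0)
    ... | divides L′@(suc _) refl | _ , k<a , divides t@(suc _) m+k≡ta =
          smaller (m<m*n L′ a (s≤s (s≤s z≤n))) t z<s z<s (period-contract k<a m+k≡ta z<s per)

  w : Word
  w n = ν (suc n)

  -- A p/q-power factor with p/q ≥ a would give w, hence ν, a window of length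
  -- a·|v| with period |v|, since ⌊p/q⌋ ≥ a.
  w-avoids-≥a : AvoidsGe a w
  w-avoids-≥a p q _ aq≤p i n (v , 0<|v| , _ , eq) =
    ruler-aperiodic (length v) (suc i) 0<|v| z<s
      (λ k k+L<aL → fracPow-period w i n v p q {{_}} {{>-nonZero 0<|v|}} eq k (<-≤-trans k+L<aL aL≤bL))
    where
    a≤p/q : a ≤ p / q
    a≤p/q = subst (_≤ p / q) (m*n/n≡m a q) (/-monoˡ-≤ q aq≤p)
    aL≤bL : a * length v ≤ (p / q) * length v
    aL≤bL = *-monoˡ-≤ (length v) a≤p/q

  -- Blocks of P = a^(c+1) consecutive positive integers, split into a sub-blocks of length L = a^c.
  module Block (c : ℕ) where

    L P : ℕ
    L = a ^ c
    P = a * L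

    instance
      L-nonZero : NonZero L
      L-nonZero = m^n≢0 a c

    L<P : L < P
    L<P = subst (L <_) (*-comm L a) (m<m*n L a (s≤s (s≤s z≤n)))

    inside-block : ∀ M j → 0 < j → j < P → ¬ (P ∣ M * P + j)
    inside-block M j 0<j j<P P∣ = <⇒≱ j<P (∣⇒≤ {{>-nonZero 0<j}} (∣m+n∣m⇒∣n P∣ (n∣m*n M)))

    block-decomposition : ∀ M k → M * P + suc k ≡ M * P + suc (k % L) + (k / L) * L
    block-decomposition M k = begin
      M * P + suc k                     ≡⟨ cong (λ x → M * P + suc x) (m≡m%n+[m/n]*n k L) ⟩
      M * P + suc (k % L + (k / L) * L) ≡⟨ +-assoc (M * P) (suc (k % L)) ((k / L) * L) ⟨
      M * P + suc (k % L) + (k / L) * L ∎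

    start-inside : ∀ M k → ¬ (P ∣ M * P + suc (k % L))
    start-inside M k = inside-block M (suc (k % L)) z<s (<-≤-trans (s≤s (m%n<n k L)) L<P)

    ν-within-block : ∀ M k → suc k < P → ν (M * P + suc k) ≡ ν (M * P + suc (k % L))
    ν-within-block M k k+1<P = begin
      ν (M * P + suc k)                     ≡⟨ cong ν (block-decomposition M k) ⟩
      ν (M * P + suc (k % L) + (k / L) * L) ≡⟨ ν-shift c _ (k / L) (start-inside M k) end∤ ⟨
      ν (M * P + suc (k % L))               ∎
      where
      end∤ : ¬ (P ∣ M * P + suc (k % L) + (k / L) * L)
      end∤ = subst (¬_ ∘ (P ∣_)) (block-decomposition M k) (inside-block M (suc k) z<s k+1<P)

    -- … and for the last position k of the block, M·P + (k mod L) + 1 has valuation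
    -- exactly c (it is a multiple of L = a^c inside the block).
    ν-end-of-block : ∀ M k → suc k ≡ P → ν (M * P + suc (k % L)) ≡ c
    ν-end-of-block M k k+1≡P = ν-exact c (∣m+n∣n⇒∣m L∣end (n∣m*n (k / L))) (start-inside M k)
      where
      L∣end : L ∣ M * P + suc (k % L) + (k / L) * L
      L∣end = subst (L ∣_) (trans (cong (M * P +_) (sym k+1≡P)) (block-decomposition M k))
                (∣m∣n⇒∣m+n (∣-trans (n∣m*n a) (n∣m*n M)) (n∣m*n a))

  block-ending-at : ∀ c i → c < ν (suc i) → Σ ℕ λ M → M * (a * a ^ c) + a * a ^ c ≡ suc i
  block-ending-at c i c<ν with ν-sound (suc c) z<s c<ν
  ... | divides zero    i+1≡0 = ⊥-elim (1+n≢0 i+1≡0)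
  ... | divides (suc M) i+1≡ = M , trans (+-comm (M * (a * a ^ c)) (a * a ^ c)) (sym i+1≡)

  -- A word agreeing with w before position i but smaller at i contains an
  -- a-power: with c = u(i), the block of length a^(c+1) ending at i is the
  -- a-th power of its first a^c letters.
  smaller-letter-forces-power : ∀ u i → (∀ j → j < i → w j ≡ u j) → u i < w i →
                                Σ ℕ λ s → Σ ℕ λ n → IsFracPower a 1 (factor u s n)
  smaller-letter-forces-power u i agree u<w with block-ending-at (u i) i u<w
  ... | M , s+P≡i+1 = s , P , factor u s L , 0<|v| , 1∣ _ , a-power
    where
    open Block (u i)
    s : ℕ
    s = M * P
    0<|v| : 0 < length (factor u s L)
    0<|v| = subst (0 <_) (sym (length-factor u s L)) (>-nonZero⁻¹ L)
    ruler-letter : ∀ k → suc k < P → u (s + k) ≡ ν (s + suc k)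
    ruler-letter k k+1<P = trans (sym (agree (s + k) s+k<i)) (cong ν (sym (+-suc s k)))
      where
      s+k<i : s + k < i
      s+k<i = subst (_≤ i) (+-suc s k) (≤-pred (subst (s + suc k <_) s+P≡i+1 (+-monoʳ-< s k+1<P)))
    periodic : ∀ k → k < a * L → u (s + k) ≡ u (s + k % L)
    periodic k k<P with suc k <? P
    ... | yes k+1<P = begin
      u (s + k)               ≡⟨ ruler-letter k k+1<P ⟩
      ν (s + suc k)           ≡⟨ ν-within-block M k k+1<P ⟩
      ν (s + suc (k % L))     ≡⟨ ruler-letter (k % L) (<-≤-trans (s≤s (m%n<n k L)) L<P) ⟨
      u (s + k % L)           ∎
    ... | no  k+1≮P = begin
      u (s + k)               ≡⟨ cong u s+k≡i ⟩
      u i                     ≡⟨ ν-end-of-block M k k+1≡P ⟨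
      ν (s + suc (k % L))     ≡⟨ ruler-letter (k % L) (<-≤-trans (s≤s (m%n<n k L)) L<P) ⟨
      u (s + k % L)           ∎
      where
      k+1≡P : suc k ≡ P
      k+1≡P = ≤-antisym k<P (≮⇒≥ k+1≮P)
      s+k≡i : s + k ≡ i
      s+k≡i = suc-injective (trans (sym (+-suc s k)) (trans (cong (s +_) k+1≡P) s+P≡i+1))
    a-power : factor u s P ≡ fracPow (factor u s L) a 1
    a-power = trans (factor-rep u s a L periodic) (sym (fracPow-integer (factor u s L) a))

  w-lex-below : ∀ u → AvoidsPow a u → LexLE w u
  w-lex-below u avoids i agree with w i ≤? u i
  ... | yes w≤u = w≤u
  ... | no  w≰u with smaller-letter-forces-power u i agree (≰⇒> w≰u)
  ...   | s , n , power = ⊥-elim (avoids s n power)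

avoidsGe⇒avoidsPow : ∀ a u → AvoidsGe a u → AvoidsPow a u
avoidsGe⇒avoidsPow a u avoids = avoids a 1 (coprime-sym (1-coprimeTo a)) (≤-reflexive (*-identityʳ a))

LexLeast-restrict : ∀ {P Q : Word → Set} {u} → (∀ v → Q v → P v) → Q u → LexLeast P u → LexLeast Q u
LexLeast-restrict Q⊆P Qu (_ , least) = Qu , λ v Qv → least v (Q⊆P v Qv)

proposition2p11 : (a : ℕ) → 2 ≤ a →
    Σ Word λ w → LexLeast (AvoidsPow a) w × LexLeast (AvoidsGe a) w
proposition2p11 (suc (suc a′)) (s≤s (s≤s z≤n)) =
  w , least-avoiding-powers , LexLeast-restrict (avoidsGe⇒avoidsPow a) w-avoids-≥a least-avoiding-powers
  where
  open Ruler a′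
  least-avoiding-powers : LexLeast (AvoidsPow a) w
  least-avoiding-powers = avoidsGe⇒avoidsPow a w w-avoids-≥a , w-lex-below
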